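{- For every integer $k\ge 4$, $\gamma(k)\ge 5\cdot 2^{k-2}-1$.
   Context: A word is a finite sequence of letters. An occurrence of a word $C$ as a subsequence of a word $S$ is an increasing sequence of positions $i_0<\cdots<i_{|C|-1}$ of $S$ with $S[i_j]=C[j]$. $C$ is an s-cover of $S$ if every position of $S$ lies in some occurrence of $C$ as a subsequence of $S$. An s-cover $C$ of $S$ is non-trivial if $|C|<|S|$; $S$ is s-primitive if it has no non-trivial s-cover. $\gamma(k)$ denotes the length of a longest s-primitive word over an alphabet of size $k$. -}

module Defs where

open import Data.Nat using (ℕ; _<_)
open import Data.Fin using (Fin) renaming (_<_ to _<ᶠ_)
open import Data.List using (List; length; lookup)
open import Data.Product using (Σ; ∃; ∃-syntax; _×_)
open import Relation.Binary.PropositionalEquality using (_≡_)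
open import Relation.Nullary using (¬_)

Word : Set → Set
Word A = List A

record Occurrence {A : Set} (C S : Word A) : Set where
  field
    pos        : Fin (length C) → Fin (length S)
    increasing : ∀ (i j : Fin (length C)) → i <ᶠ j → pos i <ᶠ pos j
    matches    : ∀ (j : Fin (length C)) → lookup S (pos j) ≡ lookup C j

IsSCover : {A : Set} → Word A → Word A → Set
IsSCover C S =
  ∀ (i : Fin (length S)) → ∃[ occ ] ∃[ j ] (Occurrence.pos {C = C} {S = S} occ j ≡ i)

IsSPrimitive : {A : Set} → Word A → Set
IsSPrimitive {A} S = ∀ (C : Word A) → length C < length S → ¬ IsSCover C S

-- An s-cover C of S matches every splitting S = U a V by a splitting C = X a Y
-- with X a subsequence of U and Y one of V.  If the letter c
-- does not occur in T, a cover C of T c T must match the middle c by a splitting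
-- C = X c Y; matching the positions of the left copy of T shows that X covers T,
-- and the right copy shows that Y covers T.  As |X| + |Y| < 2|T|, one of them is
-- a non-trivial cover of T, so T c T is s-primitive whenever T is.  Doubling k - 4
-- times from an s-primitive word of length 19 over four letters, which is
-- confirmed by an exhaustive search pruned to viable prefixes, gives an
-- s-primitive word of length 5 · 2^(k-2) - 1 over k letters.

module Submission where

open import Defs
open import Data.Nat using (ℕ; zero; suc; _≤_; _<_; _+_; _*_; _∸_; _^_; z≤n; s≤s; z<s; s<s; s<s⁻¹; pred)
open import Data.Nat.Properties
  using (≤-refl; ≤-<-trans; <⇒≤; <-≤-trans; +-cancelˡ-<; +-monoˡ-≤; ≮⇒≥; <⇒≤pred; <-irrefl; *-distribˡ-+; +-identityʳ; ≤-reflexive)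
  renaming (_≟_ to _≟ℕ_; _<?_ to _<ℕ?_)
open import Data.Fin as Fin using (Fin; toℕ; fromℕ; inject₁; punchOut; #_) renaming (_<_ to _<ᶠ_; _≤_ to _≤ᶠ_)
open import Data.Fin.Properties using (¬Fin0; 0≢1+n; suc-injective; <⇒≢; punchIn-punchOut; toℕ<n; toℕ-inject₁; toℕ-fromℕ)
open import Data.List using (List; []; _∷_; _++_; [_]; length; lookup; map; deduplicate)
open import Data.List.Properties using (∷-injective; ++-assoc; ++-identityʳ; length-++; length-map; map-++; map-∘; map-cong)
open import Data.List.Membership.Propositional using (_∉_)
open import Data.List.Membership.Propositional.Properties using (∈-insert; ∈-++⁺ˡ; ∈-++⁺ʳ; ∈-map⁻; ∈-deduplicate⁺)
open import Data.List.Relation.Unary.All as All using (All; all?)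
open import Data.List.Relation.Unary.Any using (here; there)
open import Data.List.Relation.Binary.Sublist.Propositional as Sublist using (_⊆_; []; _∷_; _∷ʳ_; ⊆-refl; ⊆-trans)
open import Data.List.Relation.Binary.Sublist.Propositional.Properties using ([]⊆-universal; map⁺; ++⁺ʳ)
open import Data.Product using (∃-syntax; _×_; _,_; proj₁; proj₂)
open import Data.Sum using (_⊎_; inj₁; inj₂; [_,_]′)
open import Data.Empty using (⊥-elim)
open import Function using (_∘_)
open import Relation.Binary.Definitions using (DecidableEquality)
open import Relation.Binary.PropositionalEquality using (_≡_; _≢_; refl; sym; trans; cong; cong₂; subst; subst₂; module ≡-Reasoning)
open import Relation.Nullary using (¬_; Dec; yes; no)
open import Relation.Nullary.Decidable using (map′; _×-dec_; _⊎-dec_; ¬?; from-yes)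

private
  variable
    A B : Set
    a c s u : A
    C P Q S T U V X Y : List A

CoversAt : List A → List A → A → List A → Set
CoversAt C U a V = ∃[ X ] ∃[ Y ] (C ≡ X ++ a ∷ Y × X ⊆ U × Y ⊆ V)

-- Positions of S are represented by its splittings S ≡ U ++ a ∷ V.
SplitCover : List A → List A → Set
SplitCover C S = ∀ {U a V} → S ≡ U ++ a ∷ V → CoversAt C U a V

SplitPrimitive : List A → Set
SplitPrimitive S = ∀ C → length C < length S → ¬ SplitCover C S

coversAt-∷ : c ≡ u → CoversAt C U a V → CoversAt (c ∷ C) (u ∷ U) a V
coversAt-∷ c≡u (X , Y , refl , X⊆U , Y⊆V) = _ ∷ X , Y , refl , c≡u ∷ X⊆U , Y⊆V

coversAt-∷ʳ : CoversAt C U a V → CoversAt C (u ∷ U) a V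
coversAt-∷ʳ (X , Y , C≡ , X⊆U , Y⊆V) = X , Y , C≡ , _ ∷ʳ X⊆U , Y⊆V

splitCover⇒⊆ : SplitCover C S → 0 < length S → C ⊆ S
splitCover⇒⊆ {S = s ∷ S} cover _ with cover {[]} {s} {S} refl
... | _ , _ , refl , [] , Y⊆S = refl ∷ Y⊆S

open Occurrence

tail-occurrence : Occurrence (c ∷ C) S → Occurrence C S
tail-occurrence occ = record
  { pos        = pos occ ∘ Fin.suc
  ; increasing = λ i j i<j → increasing occ (Fin.suc i) (Fin.suc j) (s<s i<j)
  ; matches    = matches occ ∘ Fin.suc
  }

shift-occurrence : (occ : Occurrence C (s ∷ S)) → (∀ j → 0 < toℕ (pos occ j)) → Occurrence C S
shift-occurrence {s = s} {S = S} occ 0<pos = record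
  { pos        = pos′
  ; increasing = λ i j i<j → s<s⁻¹ (subst₂ _<ᶠ_ (sym (suc-pos′ i)) (sym (suc-pos′ j)) (increasing occ i j i<j))
  ; matches    = λ j → trans (cong (lookup (s ∷ S)) (suc-pos′ j)) (matches occ j)
  }
  where
    -- punchOut away from zero is the predecessor.
    pos′ : ∀ j → Fin (length S)
    pos′ j = punchOut (<⇒≢ {i = Fin.zero} (0<pos j))

    suc-pos′ : ∀ j → Fin.suc (pos′ j) ≡ pos occ j
    suc-pos′ j = punchIn-punchOut (<⇒≢ {i = Fin.zero} (0<pos j))

shift-occurrence-pos : (occ : Occurrence C (s ∷ S)) (0<pos : ∀ j → 0 < toℕ (pos occ j)) →
                       ∀ j → pos occ j ≡ Fin.suc (pos (shift-occurrence occ 0<pos) j)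
shift-occurrence-pos occ 0<pos j = sym (punchIn-punchOut (<⇒≢ {i = Fin.zero} (0<pos j)))

pos-zero-≤ : (occ : Occurrence (c ∷ C) S) → ∀ j → pos occ Fin.zero ≤ᶠ pos occ j
pos-zero-≤ occ Fin.zero    = ≤-refl
pos-zero-≤ occ (Fin.suc j) = <⇒≤ (increasing occ Fin.zero (Fin.suc j) z<s)

data FirstLetterView {c : A} {C s S} (occ : Occurrence (c ∷ C) (s ∷ S)) : Set where
  matched : c ≡ s → pos occ Fin.zero ≡ Fin.zero → (occ′ : Occurrence C S) →
            (∀ j → pos occ (Fin.suc j) ≡ Fin.suc (pos occ′ j)) → FirstLetterView occ
  skipped : (occ′ : Occurrence (c ∷ C) S) →
            (∀ j → pos occ j ≡ Fin.suc (pos occ′ j)) → FirstLetterView occ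

firstLetterView : (occ : Occurrence (c ∷ C) (s ∷ S)) → FirstLetterView occ
firstLetterView {c = c} {s = s} {S = S} occ with pos occ Fin.zero in first
... | Fin.zero  =
  matched c≡s first (shift-occurrence (tail-occurrence occ) 0<pos) (shift-occurrence-pos (tail-occurrence occ) 0<pos)
  where
    c≡s : c ≡ s
    c≡s = trans (sym (matches occ Fin.zero)) (cong (lookup (s ∷ S)) first)

    0<pos : ∀ j → 0 < toℕ (pos occ (Fin.suc j))
    0<pos j = ≤-<-trans z≤n (increasing occ Fin.zero (Fin.suc j) z<s)
... | Fin.suc _ = skipped (shift-occurrence occ 0<pos) (shift-occurrence-pos occ 0<pos)
  where
    0<pos : ∀ j → 0 < toℕ (pos occ j)
    0<pos j = <-≤-trans (subst (λ i → 0 < toℕ i) (sym first) z<s) (pos-zero-≤ occ j)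

occurrence⇒⊆ : Occurrence C S → C ⊆ S
occurrence⇒⊆ {C = []}              _   = []⊆-universal _
occurrence⇒⊆ {C = _ ∷ _} {S = []}    occ = ⊥-elim (¬Fin0 (pos occ Fin.zero))
occurrence⇒⊆ {C = _ ∷ _} {S = _ ∷ _} occ with firstLetterView occ
... | matched c≡s _ occ′ _ = c≡s ∷ occurrence⇒⊆ occ′
... | skipped occ′ _       = _ ∷ʳ occurrence⇒⊆ occ′

middle : ∀ U {a : A} {V} → Fin (length (U ++ a ∷ V))
middle []      = Fin.zero
middle (_ ∷ U) = Fin.suc (middle U)

occurrence-through-middle : ∀ U (occ : Occurrence C (U ++ a ∷ V)) j → pos occ j ≡ middle U → CoversAt C U a V
occurrence-through-middle {C = []} _ occ () _
occurrence-through-middle {C = c ∷ C} [] occ j hit with firstLetterView occ | j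
... | matched c≡a _ occ′ _ | Fin.zero  = [] , C , cong (_∷ C) c≡a , [] , occurrence⇒⊆ occ′
... | matched _ _ _ shifted | Fin.suc j = ⊥-elim (0≢1+n (trans (sym hit) (shifted j)))
... | skipped _ shifted     | j         = ⊥-elim (0≢1+n (trans (sym hit) (shifted j)))
occurrence-through-middle {C = c ∷ C} (u ∷ U) occ j hit with firstLetterView occ | j
... | matched _ first _ _        | Fin.zero  = ⊥-elim (0≢1+n (trans (sym first) hit))
... | matched c≡u _ occ′ shifted | Fin.suc j =
  coversAt-∷ c≡u (occurrence-through-middle U occ′ j (suc-injective (trans (sym (shifted j)) hit)))
... | skipped occ′ shifted       | j         =
  coversAt-∷ʳ (occurrence-through-middle U occ′ j (suc-injective (trans (sym (shifted j)) hit)))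

isSCover⇒splitCover : IsSCover C S → SplitCover C S
isSCover⇒splitCover cover {U} refl with cover (middle U)
... | occ , j , hit = occurrence-through-middle U occ j hit

splitPrimitive⇒isSPrimitive : SplitPrimitive S → IsSPrimitive S
splitPrimitive⇒isSPrimitive prim C |C|<|S| = prim C |C|<|S| ∘ isSCover⇒splitCover

distinct-splits-ordered : ∀ X₁ {Y₁} X₂ {Y₂} → X₁ ++ a ∷ Y₁ ≡ X₂ ++ c ∷ Y₂ → a ≢ c →
  (∃[ Z ] (X₂ ≡ X₁ ++ a ∷ Z × Y₁ ≡ Z ++ c ∷ Y₂)) ⊎ (∃[ Z ] (X₁ ≡ X₂ ++ c ∷ Z × Y₂ ≡ Z ++ a ∷ Y₁))
distinct-splits-ordered []       []       refl a≢c = ⊥-elim (a≢c refl)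
distinct-splits-ordered []       (_ ∷ X₂) refl _   = inj₁ (X₂ , refl , refl)
distinct-splits-ordered (_ ∷ X₁) []       refl _   = inj₂ (X₁ , refl , refl)
distinct-splits-ordered (x ∷ X₁) (_ ∷ X₂) eq   a≢c with ∷-injective eq
... | refl , eq′ with distinct-splits-ordered X₁ X₂ eq′ a≢c
...   | inj₁ (Z , refl , Y₁≡) = inj₁ (Z , refl , Y₁≡)
...   | inj₂ (Z , refl , Y₂≡) = inj₂ (Z , refl , Y₂≡)

⊆-split-at-unique : c ∉ U → c ∉ V → X ++ c ∷ Y ⊆ U ++ c ∷ V → X ⊆ U × Y ⊆ V
⊆-split-at-unique {U = []} {X = []} _ c∉V (refl ∷ Y⊆V) = [] , Y⊆V
⊆-split-at-unique {U = []} {X = []} _ c∉V (_ ∷ʳ σ) = ⊥-elim (c∉V (Sublist.lookup σ (here refl)))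
⊆-split-at-unique {U = []} {X = x ∷ X} _ c∉V (_ ∷ σ) = ⊥-elim (c∉V (Sublist.lookup σ (∈-insert X)))
⊆-split-at-unique {U = []} {X = x ∷ X} _ c∉V (_ ∷ʳ σ) = ⊥-elim (c∉V (Sublist.lookup σ (∈-insert (x ∷ X))))
⊆-split-at-unique {U = u ∷ U} {X = []} c∉U _ (c≡u ∷ _) = ⊥-elim (c∉U (here c≡u))
⊆-split-at-unique {U = u ∷ U} {X = x ∷ X} c∉U c∉V (x≡u ∷ σ) with ⊆-split-at-unique (c∉U ∘ there) c∉V σ
... | X⊆U , Y⊆V = x≡u ∷ X⊆U , Y⊆V
⊆-split-at-unique {U = u ∷ U} {X = X} c∉U c∉V (_ ∷ʳ σ) with ⊆-split-at-unique {X = X} (c∉U ∘ there) c∉V σ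
... | X⊆U , Y⊆V = u ∷ʳ X⊆U , Y⊆V

∉-++-∷⁻ : c ∉ U ++ a ∷ V → c ∉ U × a ≢ c × c ∉ V
∉-++-∷⁻ {U = U} c∉ = c∉ ∘ ∈-++⁺ˡ , (λ a≡c → c∉ (∈-++⁺ʳ U (here (sym a≡c)))) , c∉ ∘ ∈-++⁺ʳ U ∘ there

-- Since c ∉ T, a position of the left copy of T is matched to the left of the
-- letter c of C matched to the middle; symmetrically for the right copy.
splitCover-left : c ∉ T → SplitCover (X ++ c ∷ Y) (T ++ c ∷ T) → SplitCover X T
splitCover-left {c = c} {X = X} c∉T cover {U} {a} {V} refl
  with ∉-++-∷⁻ c∉T | cover {U} {a} {V ++ c ∷ U ++ a ∷ V} (++-assoc U (a ∷ V) (c ∷ U ++ a ∷ V))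
... | c∉U , a≢c , c∉V | X′ , Y′ , XcY≡ , X′⊆U , Y′⊆ with distinct-splits-ordered X′ X (sym XcY≡) a≢c
...   | inj₁ (Z , refl , refl) = X′ , Z , refl , X′⊆U , proj₁ (⊆-split-at-unique c∉V c∉T Y′⊆)
...   | inj₂ (Z , refl , _)    = ⊥-elim (c∉U (Sublist.lookup X′⊆U (∈-insert X)))

splitCover-right : c ∉ T → SplitCover (X ++ c ∷ Y) (T ++ c ∷ T) → SplitCover Y T
splitCover-right {c = c} {X = X} c∉T cover {U} {a} {V} refl
  with ∉-++-∷⁻ c∉T | cover {(U ++ a ∷ V) ++ c ∷ U} {a} {V} (sym (++-assoc (U ++ a ∷ V) (c ∷ U) (a ∷ V)))
... | c∉U , a≢c , c∉V | X′ , Y′ , XcY≡ , X′⊆ , Y′⊆V with distinct-splits-ordered X′ X (sym XcY≡) a≢c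
...   | inj₁ (Z , refl , refl) = ⊥-elim (c∉V (Sublist.lookup Y′⊆V (∈-insert Z)))
...   | inj₂ (Z , refl , refl) = Z , Y′ , refl , proj₂ (⊆-split-at-unique c∉T c∉U X′⊆) , Y′⊆V

m+1+n<o+1+o⇒m<o⊎n<o : ∀ m n o → m + suc n < o + suc o → m < o ⊎ n < o
m+1+n<o+1+o⇒m<o⊎n<o m n o lt with m <ℕ? o
... | yes m<o = inj₁ m<o
... | no  m≮o = inj₂ (s<s⁻¹ (+-cancelˡ-< o (suc n) (suc o) (≤-<-trans (+-monoˡ-≤ (suc n) (≮⇒≥ m≮o)) lt)))

splitPrimitive-double : c ∉ T → SplitPrimitive T → SplitPrimitive (T ++ c ∷ T)
splitPrimitive-double {c = c} {T = T} c∉T prim C |C|<|S| cover with cover {T} {c} {T} refl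
... | X , Y , refl , _
  with m+1+n<o+1+o⇒m<o⊎n<o (length X) (length Y) (length T) (subst₂ _<_ (length-++ X) (length-++ T) |C|<|S|)
...   | inj₁ |X|<|T| = prim X |X|<|T| (splitCover-left c∉T cover)
...   | inj₂ |Y|<|T| = prim Y |Y|<|T| (splitCover-right c∉T cover)

map-≡-++-∷⁻ : (f : A → B) → ∀ S {U b V} → map f S ≡ U ++ b ∷ V →
  ∃[ U′ ] ∃[ a ] ∃[ V′ ] (S ≡ U′ ++ a ∷ V′ × U ≡ map f U′ × b ≡ f a × V ≡ map f V′)
map-≡-++-∷⁻ f []      {[]}    ()
map-≡-++-∷⁻ f []      {_ ∷ _} ()
map-≡-++-∷⁻ f (s ∷ S) {[]}    refl = [] , s , S , refl , refl , refl , refl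
map-≡-++-∷⁻ f (s ∷ S) {_ ∷ _} eq with ∷-injective eq
... | refl , eq′ with map-≡-++-∷⁻ f S eq′
...   | U′ , a , V′ , refl , refl , refl , refl = s ∷ U′ , a , V′ , refl , refl , refl , refl

splitCover-map : (f : A → B) → SplitCover C S → SplitCover (map f C) (map f S)
splitCover-map {S = S} f cover eq with map-≡-++-∷⁻ f S eq
... | U , a , V , refl , refl , refl , refl with cover {U} {a} {V} refl
...   | X , Y , refl , X⊆U , Y⊆V = map f X , map f Y , map-++ f X (a ∷ Y) , map⁺ f X⊆U , map⁺ f Y⊆V

splitPrimitive-map⁻ : (f : A → B) → SplitPrimitive (map f S) → SplitPrimitive S
splitPrimitive-map⁻ {S = S} f prim C |C|<|S| =
  prim (map f C) (subst₂ _<_ (sym (length-map f C)) (sym (length-map f S)) |C|<|S|) ∘ splitCover-map f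

Viable : List A → List A → Set
Viable P S = ∀ {U a V} → S ≡ U ++ a ∷ V → CoversAt P U a V ⊎ P ⊆ U

++-≡-++-∷⁻ : ∀ P {Q} X {Y} → P ++ Q ≡ X ++ a ∷ Y →
  (∃[ Y₁ ] (P ≡ X ++ a ∷ Y₁ × Y ≡ Y₁ ++ Q)) ⊎ (∃[ Z ] (X ≡ P ++ Z))
++-≡-++-∷⁻ []      X       _    = inj₂ (X , refl)
++-≡-++-∷⁻ (_ ∷ P) []      refl = inj₁ (P , refl , refl)
++-≡-++-∷⁻ (_ ∷ P) (_ ∷ X) eq   with ∷-injective eq
... | refl , eq′ with ++-≡-++-∷⁻ P X eq′
...   | inj₁ (Y₁ , refl , Y≡) = inj₁ (Y₁ , refl , Y≡)
...   | inj₂ (Z , refl)       = inj₂ (Z , refl)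

splitCover⇒viable : SplitCover (P ++ Q) S → Viable P S
splitCover⇒viable {P = P} {Q = Q} cover eq with cover eq
... | X , Y , PQ≡ , X⊆U , Y⊆V with ++-≡-++-∷⁻ P X PQ≡
...   | inj₁ (Y₁ , P≡ , refl) = inj₁ (X , Y₁ , P≡ , X⊆U , ⊆-trans (++⁺ʳ Q ⊆-refl) Y⊆V)
...   | inj₂ (Z , refl)       = inj₂ (⊆-trans (++⁺ʳ Z ⊆-refl) X⊆U)

module _ (_≟_ : DecidableEquality A) where

  open import Data.List.Relation.Binary.Sublist.DecPropositional _≟_ using (_⊆?_)

  splitAt? : {R : List A → List A → Set} → (∀ X Y → Dec (R X Y)) →
             ∀ a C → Dec (∃[ X ] ∃[ Y ] (C ≡ X ++ a ∷ Y × R X Y))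
  splitAt? R? a []      = no λ { ([] , _ , () , _) ; (_ ∷ _ , _ , () , _) }
  splitAt? {R} R? a (c ∷ C) = map′ join separate ((c ≟ a ×-dec R? [] C) ⊎-dec splitAt? (λ X → R? (c ∷ X)) a C)
    where
      join : (c ≡ a × R [] C) ⊎ (∃[ X ] ∃[ Y ] (C ≡ X ++ a ∷ Y × R (c ∷ X) Y)) →
             ∃[ X ] ∃[ Y ] (c ∷ C ≡ X ++ a ∷ Y × R X Y)
      join (inj₁ (c≡a , r))        = [] , C , cong (_∷ C) c≡a , r
      join (inj₂ (X , Y , C≡ , r)) = c ∷ X , Y , cong (c ∷_) C≡ , r

      separate : ∃[ X ] ∃[ Y ] (c ∷ C ≡ X ++ a ∷ Y × R X Y) →
                 (c ≡ a × R [] C) ⊎ (∃[ X ] ∃[ Y ] (C ≡ X ++ a ∷ Y × R (c ∷ X) Y))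
      separate ([] , Y , eq , r) with ∷-injective eq
      ... | c≡a , refl = inj₁ (c≡a , r)
      separate (x ∷ X , Y , eq , r) with ∷-injective eq
      ... | refl , C≡ = inj₂ (X , Y , C≡ , r)

  everySplit? : {Q : List A → A → List A → Set} → (∀ U a V → Dec (Q U a V)) →
                ∀ S → Dec (∀ {U a V} → S ≡ U ++ a ∷ V → Q U a V)
  everySplit? Q? []      = yes λ { {[]} () ; {_ ∷ _} () }
  everySplit? {Q} Q? (s ∷ S) = map′ join separate (Q? [] s S ×-dec everySplit? (λ U → Q? (s ∷ U)) S)
    where
      join : Q [] s S × (∀ {U a V} → S ≡ U ++ a ∷ V → Q (s ∷ U) a V) →
             ∀ {U a V} → s ∷ S ≡ U ++ a ∷ V → Q U a V
      join (q , _)  {[]}    eq with ∷-injective eq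
      ... | refl , refl = q
      join (_ , qs) {_ ∷ _} eq with ∷-injective eq
      ... | refl , S≡ = qs S≡

      separate : (∀ {U a V} → s ∷ S ≡ U ++ a ∷ V → Q U a V) →
                 Q [] s S × (∀ {U a V} → S ≡ U ++ a ∷ V → Q (s ∷ U) a V)
      separate q = q refl , q ∘ cong (s ∷_)

  coversAt? : ∀ C U a V → Dec (CoversAt C U a V)
  coversAt? C U a V = splitAt? (λ X Y → X ⊆? U ×-dec Y ⊆? V) a C

  splitCover? : ∀ C S → Dec (SplitCover C S)
  splitCover? C = everySplit? (coversAt? C)

  viable? : ∀ P S → Dec (Viable P S)
  viable? P = everySplit? (λ U a V → coversAt? P U a V ⊎-dec P ⊆? U)

module Search (_≟_ : DecidableEquality A) (S : List A) where

  letters : List A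
  letters = deduplicate _≟_ S

  Refuted : ℕ → List A → Set
  Refuted zero    P = ¬ SplitCover P S
  Refuted (suc f) P = ¬ SplitCover P S × All (λ x → ¬ Viable (P ++ [ x ]) S ⊎ Refuted f (P ++ [ x ])) letters

  refuted? : ∀ f P → Dec (Refuted f P)
  refuted? zero    P = ¬? (splitCover? _≟_ P S)
  refuted? (suc f) P = ¬? (splitCover? _≟_ P S)
    ×-dec all? (λ x → ¬? (viable? _≟_ (P ++ [ x ]) S) ⊎-dec refuted? f (P ++ [ x ])) letters

  refuted-sound : ∀ f P → Refuted f P → ∀ Q → length Q ≤ f → P ++ Q ⊆ S → ¬ SplitCover (P ++ Q) S
  refuted-sound zero    P ¬cover       []      _ _ = ¬cover ∘ subst (λ C → SplitCover C S) (++-identityʳ P)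
  refuted-sound (suc f) P (¬cover , _) []      _ _ = ¬cover ∘ subst (λ C → SplitCover C S) (++-identityʳ P)
  refuted-sound (suc f) P (_ , next)   (x ∷ Q) (s≤s |Q|≤f) PxQ⊆S cover =
    [ (λ ¬viable → ¬viable (splitCover⇒viable cover′))
    , (λ refuted → refuted-sound f (P ++ [ x ]) refuted Q |Q|≤f (subst (_⊆ S) reassoc PxQ⊆S) cover′)
    ]′ (All.lookup next (∈-deduplicate⁺ _≟_ (Sublist.lookup PxQ⊆S (∈-insert P))))
    where
      reassoc : P ++ x ∷ Q ≡ (P ++ [ x ]) ++ Q
      reassoc = sym (++-assoc P [ x ] Q)

      cover′ : SplitCover ((P ++ [ x ]) ++ Q) S
      cover′ = subst (λ C → SplitCover C S) reassoc cover

  splitPrimitive-by-search : Refuted (pred (length S)) [] → SplitPrimitive S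
  splitPrimitive-by-search refuted C |C|<|S| cover =
    refuted-sound _ [] refuted C (<⇒≤pred |C|<|S|) (splitCover⇒⊆ cover (≤-<-trans z≤n |C|<|S|)) cover

seed : List (Fin 4)
seed = # 0 ∷ # 1 ∷ # 0 ∷ # 2 ∷ # 3 ∷ # 0 ∷ # 1 ∷ # 3 ∷ # 0 ∷ # 3
     ∷ # 2 ∷ # 1 ∷ # 0 ∷ # 2 ∷ # 0 ∷ # 1 ∷ # 3 ∷ # 1 ∷ # 2 ∷ []

seed-splitPrimitive : SplitPrimitive (map toℕ seed)
seed-splitPrimitive = splitPrimitive-by-search (from-yes (refuted? 18 []))
  where open Search _≟ℕ_ (map toℕ seed)

word : ∀ n → List (Fin (4 + n))
word zero    = seed
word (suc n) = map inject₁ (word n) ++ fromℕ (4 + n) ∷ map inject₁ (word n)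

map-toℕ-inject₁ : ∀ {n} (w : List (Fin n)) → map toℕ (map inject₁ w) ≡ map toℕ w
map-toℕ-inject₁ w = trans (sym (map-∘ w)) (map-cong toℕ-inject₁ w)

map-toℕ-word : ∀ n → map toℕ (word (suc n)) ≡ map toℕ (word n) ++ (4 + n) ∷ map toℕ (word n)
map-toℕ-word n = begin
  map toℕ (map inject₁ w ++ fromℕ (4 + n) ∷ map inject₁ w)
    ≡⟨ map-++ toℕ (map inject₁ w) _ ⟩
  map toℕ (map inject₁ w) ++ toℕ (fromℕ (4 + n)) ∷ map toℕ (map inject₁ w)
    ≡⟨ cong₂ (λ v m → v ++ m ∷ v) (map-toℕ-inject₁ w) (toℕ-fromℕ (4 + n)) ⟩
  map toℕ w ++ (4 + n) ∷ map toℕ w ∎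
  where
    open ≡-Reasoning
    w : List (Fin (4 + n))
    w = word n

n∉map-toℕ : ∀ {n} (w : List (Fin n)) → n ∉ map toℕ w
n∉map-toℕ w n∈ with ∈-map⁻ toℕ n∈
... | i , _ , n≡i = <-irrefl (sym n≡i) (toℕ<n i)

word-splitPrimitive : ∀ n → SplitPrimitive (map toℕ (word n))
word-splitPrimitive zero    = seed-splitPrimitive
word-splitPrimitive (suc n) = subst SplitPrimitive (sym (map-toℕ-word n))
  (splitPrimitive-double (n∉map-toℕ (word n)) (word-splitPrimitive n))

length-word : ∀ n → suc (length (word n)) ≡ 5 * 2 ^ (2 + n)
length-word zero    = refl
length-word (suc n) = begin
  suc (length (map inject₁ w ++ fromℕ (4 + n) ∷ map inject₁ w))  ≡⟨ cong suc (length-++ (map inject₁ w)) ⟩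
  suc (length (map inject₁ w) + suc (length (map inject₁ w)))   ≡⟨ cong (λ l → suc (l + suc l)) (length-map inject₁ w) ⟩
  suc (length w) + suc (length w)                                ≡⟨ cong₂ _+_ (length-word n) (length-word n) ⟩
  5 * 2 ^ (2 + n) + 5 * 2 ^ (2 + n)                              ≡⟨ sym (*-distribˡ-+ 5 (2 ^ (2 + n)) _) ⟩
  5 * (2 ^ (2 + n) + 2 ^ (2 + n))                                ≡⟨ cong (λ m → 5 * (2 ^ (2 + n) + m)) (sym (+-identityʳ _)) ⟩
  5 * 2 ^ (3 + n)                                                ∎
  where
    open ≡-Reasoning
    w : List (Fin (4 + n))
    w = word n

theorem3 : ∀ (k : ℕ) → 4 ≤ k →
    ∃[ S ] (IsSPrimitive {Fin k} S × (5 * 2 ^ (k ∸ 2) ∸ 1 ≤ length S))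
theorem3 _ (s≤s (s≤s (s≤s (s≤s {n = n} z≤n)))) =
  word n ,
  splitPrimitive⇒isSPrimitive (splitPrimitive-map⁻ toℕ (word-splitPrimitive n)) ,
  ≤-reflexive (cong (_∸ 1) (sym (length-word n)))
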